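{- For every GNFO formula $\varphi$, the number of elements of $\mathrm{cl}(\varphi)$ up to renaming of free variables (i.e., the number of equivalence classes of $\mathrm{cl}(\varphi)$ under renaming free variables) is at most $(2\|\varphi\|)^{2\|\varphi\|}$.
   Context: Let $\mathsf{V}$ be an infinite set of variables and $\sigma$ a relational signature. Guards: $\alpha ::= R\bar x\mid\exists y\,\alpha$ with $R\in\sigma\cup\{=\}$. GNFO formulas (in this form): $\varphi ::= \alpha\mid\varphi\lor\varphi\mid\varphi\land\varphi\mid\exists x\,\varphi\mid\alpha\land\neg\varphi$ where $\mathrm{FV}(\varphi)\subseteq\mathrm{FV}(\alpha)$. $\|\varphi\|$ is the number of symbol occurrences in $\varphi$. The closure $\mathrm{cl}(\varphi)$ is a set of finite formula sets (written as lists, $(\Gamma,\Delta)$ denoting $\Gamma\cup\Delta$, $()$ the empty set) defined by: $\mathrm{cl}(\alpha)=\{(\alpha),()\}$; $\mathrm{cl}(\varphi\lor\psi)=\{(\varphi\lor\psi)\}\cup\mathrm{cl}(\varphi)\cup\mathrm{cl}(\psi)$; $\mathrm{cl}(\varphi\land\psi)=\{(\varphi\land\psi)\}\cup\{(\Gamma,\Delta)\mid\Gamma\in\mathrm{cl}(\varphi),\Delta\in\mathrm{cl}(\psi),\ \mathrm{FV}(\Gamma)\cap\mathrm{FV}(\Delta)\subseteq\mathrm{FV}(\varphi)\cap\mathrm{FV}(\psi)\}$; $\mathrm{cl}(\exists x\,\varphi)=\{(\exists x\,\varphi)\}\cup\bigcup_{z\in\mathsf{V}\setminus\mathrm{FV}(\varphi)}\mathrm{cl}(\varphi[z/x])$;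 $\mathrm{cl}(\alpha\land\neg\varphi)=\{(\alpha\land\neg\varphi)\}\cup\mathrm{cl}(\varphi)$. -}

module Defs where

open import Data.Nat using (ℕ; zero; suc; _+_; _*_; _^_; _≤_; _⊔_; _≡ᵇ_)
open import Data.Bool using (Bool; true; false; if_then_else_; _∨_)
open import Data.List using (List; []; _∷_; _++_; filter; foldr; concatMap; length)
import Data.List as List
open import Data.Vec using (Vec)
import Data.Vec as Vec
open import Data.Product using (_×_; Σ; ∃; _,_)
open import Data.List.Membership.Propositional using (_∈_; _∉_)
open import Data.List.Relation.Unary.All using (All)
open import Data.List.Relation.Unary.Any using (Any)
open import Relation.Nullary using (¬_)
open import Relation.Binary.PropositionalEquality using (_≡_)
open import Function.Bundles using (_↔_; Inverse)

record Signature : Set₁ where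
  field
    Sym   : Set
    arity : Sym → ℕ

Var : Set
Var = ℕ

module _ (Sg : Signature) where
  open Signature Sg

  data Guard : Set where
    atom : (R : Sym) → Vec Var (arity R) → Guard
    eq   : Var → Var → Guard
    gex  : Var → Guard → Guard

  data Form : Set where
    grd  : Guard → Form
    or   : Form → Form → Form
    and  : Form → Form → Form
    ex   : Var → Form → Form
    gneg : Guard → Form → Form

module _ {Sg : Signature} where
  open Signature Sg

  remove : Var → List Var → List Var
  remove y = filter (λ v → Relation.Nullary.¬? (v Data.Nat.≟ y))

  FVg : Guard Sg → List Var
  FVg (atom R xs) = Vec.toList xs
  FVg (eq x y)    = x ∷ y ∷ []
  FVg (gex y α)   = remove y (FVg α)

  FVf : Form Sg → List Var
  FVf (grd α)    = FVg α
  FVf (or φ ψ)   = FVf φ ++ FVf ψ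
  FVf (and φ ψ)  = FVf φ ++ FVf ψ
  FVf (ex x φ)   = remove x (FVf φ)
  FVf (gneg α φ) = FVg α ++ FVf φ

  FVs : List (Form Sg) → List Var
  FVs = concatMap FVf

  -- size ‖φ‖ : number of symbol occurrences
  -- (relation symbols, =, variable occurrences, ∃, ∨, ∧, ¬; no parentheses)
  sizeg : Guard Sg → ℕ
  sizeg (atom R xs) = suc (arity R)
  sizeg (eq x y)    = 3
  sizeg (gex y α)   = 2 + sizeg α

  size : Form Sg → ℕ
  size (grd α)    = sizeg α
  size (or φ ψ)   = suc (size φ + size ψ)
  size (and φ ψ)  = suc (size φ + size ψ)
  size (ex x φ)   = 2 + size φ
  size (gneg α φ) = 2 + (sizeg α + size φ)

  occurs : Var → List Var → Bool
  occurs v []       = false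
  occurs v (w ∷ ws) = (v ≡ᵇ w) ∨ occurs v ws

  fresh : List Var → Var
  fresh l = suc (foldr _⊔_ 0 l)

  upd : (Var → Var) → Var → Var → (Var → Var)
  upd ρ y w v = if v ≡ᵇ y then w else ρ v

  pick : (Var → Var) → Var → List Var → Var
  pick ρ y fv = if occurs y (List.map ρ fv) then fresh (y ∷ List.map ρ fv) else y

  reng : (Var → Var) → Guard Sg → Guard Sg
  reng ρ (atom R xs) = atom R (Vec.map ρ xs)
  reng ρ (eq x y)    = eq (ρ x) (ρ y)
  reng ρ (gex y α)   =
    let w = pick ρ y (FVg (gex y α)) in gex w (reng (upd ρ y w) α)

  renf : (Var → Var) → Form Sg → Form Sg
  renf ρ (grd α)    = grd (reng ρ α)
  renf ρ (or φ ψ)   = or (renf ρ φ) (renf ρ ψ)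
  renf ρ (and φ ψ)  = and (renf ρ φ) (renf ρ ψ)
  renf ρ (ex y φ)   =
    let w = pick ρ y (FVf (ex y φ)) in ex w (renf (upd ρ y w) φ)
  renf ρ (gneg α φ) = gneg (reng ρ α) (renf ρ φ)

  _[_/_] : Form Sg → Var → Var → Form Sg
  φ [ z / x ] = renf (upd (λ v → v) x z) φ

  data GNFO : Form Sg → Set where
    g-grd  : ∀ {α} → GNFO (grd α)
    g-or   : ∀ {φ ψ} → GNFO φ → GNFO ψ → GNFO (or φ ψ)
    g-and  : ∀ {φ ψ} → GNFO φ → GNFO ψ → GNFO (and φ ψ)
    g-ex   : ∀ {x φ} → GNFO φ → GNFO (ex x φ)
    g-gneg : ∀ {α φ} → (∀ v → v ∈ FVf φ → v ∈ FVg α) → GNFO φ → GNFO (gneg α φ)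

  -- The closure cl(φ), as a predicate on finite formula sets (lists;
  -- (Γ,Δ) is Γ ++ Δ, () is []).

  data Cl : Form Sg → List (Form Sg) → Set where
    cl-grd   : ∀ {α} → Cl (grd α) (grd α ∷ [])
    cl-empty : ∀ {α} → Cl (grd α) []
    cl-or    : ∀ {φ ψ} → Cl (or φ ψ) (or φ ψ ∷ [])
    cl-orˡ   : ∀ {φ ψ Γ} → Cl φ Γ → Cl (or φ ψ) Γ
    cl-orʳ   : ∀ {φ ψ Γ} → Cl ψ Γ → Cl (or φ ψ) Γ
    cl-and   : ∀ {φ ψ} → Cl (and φ ψ) (and φ ψ ∷ [])
    cl-and₂  : ∀ {φ ψ Γ Δ} → Cl φ Γ → Cl ψ Δ →
               (∀ v → v ∈ FVs Γ → v ∈ FVs Δ → (v ∈ FVf φ × v ∈ FVf ψ)) →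
               Cl (and φ ψ) (Γ ++ Δ)
    cl-ex    : ∀ {x φ} → Cl (ex x φ) (ex x φ ∷ [])
    cl-ex₂   : ∀ {x φ Γ} (z : Var) → z ∉ FVf φ → Cl (φ [ z / x ]) Γ → Cl (ex x φ) Γ
    cl-gneg  : ∀ {α φ} → Cl (gneg α φ) (gneg α φ ∷ [])
    cl-gneg₂ : ∀ {α φ Γ} → Cl φ Γ → Cl (gneg α φ) Γ

  -- Nameless (locally nameless) forms: bound variables become de Bruijn
  -- indices, free variables keep their names.  Two formulas are
  -- α-equivalent iff their nameless forms are equal.

  data NTerm : Set where
    fr : Var → NTerm
    bd : ℕ → NTerm

  data NGuard : Set where
    natom : (R : Sym) → Vec NTerm (arity R) → NGuard
    neq   : NTerm → NTerm → NGuard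
    ngex  : NGuard → NGuard

  data NForm : Set where
    ngrd  : NGuard → NForm
    nor   : NForm → NForm → NForm
    nand  : NForm → NForm → NForm
    nex   : NForm → NForm
    ngneg : NGuard → NForm → NForm

  bump : NTerm → NTerm
  bump (fr v) = fr v
  bump (bd i) = bd (suc i)

  var : List Var → Var → NTerm
  var []       x = fr x
  var (y ∷ ys) x = if x ≡ᵇ y then bd 0 else bump (var ys x)

  nlg : List Var → Guard Sg → NGuard
  nlg env (atom R xs) = natom R (Vec.map (var env) xs)
  nlg env (eq x y)    = neq (var env x) (var env y)
  nlg env (gex y α)   = ngex (nlg (y ∷ env) α)

  nlf : List Var → Form Sg → NForm
  nlf env (grd α)    = ngrd (nlg env α)
  nlf env (or φ ψ)   = nor (nlf env φ) (nlf env ψ)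
  nlf env (and φ ψ)  = nand (nlf env φ) (nlf env ψ)
  nlf env (ex x φ)   = nex (nlf (x ∷ env) φ)
  nlf env (gneg α φ) = ngneg (nlg env α) (nlf env φ)

  nl : Form Sg → NForm
  nl = nlf []

  rt : (Var → Var) → NTerm → NTerm
  rt ρ (fr v) = fr (ρ v)
  rt ρ (bd i) = bd i

  nrg : (Var → Var) → NGuard → NGuard
  nrg ρ (natom R ts) = natom R (Vec.map (rt ρ) ts)
  nrg ρ (neq s t)    = neq (rt ρ s) (rt ρ t)
  nrg ρ (ngex α)     = ngex (nrg ρ α)

  nrf : (Var → Var) → NForm → NForm
  nrf ρ (ngrd α)    = ngrd (nrg ρ α)
  nrf ρ (nor φ ψ)   = nor (nrf ρ φ) (nrf ρ ψ)
  nrf ρ (nand φ ψ)  = nand (nrf ρ φ) (nrf ρ ψ)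
  nrf ρ (nex φ)     = nex (nrf ρ φ)
  nrf ρ (ngneg α φ) = ngneg (nrg ρ α) (nrf ρ φ)

  -- Γ is obtained from Δ by renaming free variables: there is a
  -- permutation ρ of V such that Γ and Δρ are the same set of formulas
  -- (formulas compared up to α-equivalence).

  _≈ren_ : List (Form Sg) → List (Form Sg) → Set
  Γ ≈ren Δ = Σ (Var ↔ Var) λ ρ →
    All (λ ψ → Any (λ χ → nl ψ ≡ nrf (Inverse.to ρ) (nl χ)) Δ) Γ ×
    All (λ χ → Any (λ ψ → nl ψ ≡ nrf (Inverse.to ρ) (nl χ)) Γ) Δ

  -- "cl(φ) has at most N elements up to renaming of free variables":
  -- there is a list of at most N members of cl(φ) such that every member
  -- of cl(φ) is a renaming of one of them.
  ClassesAtMost : Form Sg → ℕ → Set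
  ClassesAtMost φ N = Σ (List (List (Form Sg))) λ reps →
    All (Cl φ) reps × length reps ≤ N ×
    (∀ Γ → Cl φ Γ → Any (λ Δ → Γ ≈ren Δ) reps)

-- A member of cl(φ) is produced by a derivation that, at each ∃x C, substitutes some z ∉ FV(C) for x, and a
-- derivation mentions at most ‖φ‖² variables.  Rename them by a bijection π of ℕ that fixes the variables of φ,
-- is increasing on the variables of the derivation, keeps consecutive ones consecutive, and closes up every gap in
-- front of a block of consecutive variables containing no variable of φ.  Such a π commutes with the `fresh`
-- choices of capture-avoiding substitution, so it turns the derivation of Γ into one of π(Γ) whose witnesses all
-- lie within ‖φ‖² of 0 or of a variable of φ, i.e. in a fixed list Zs of O(‖φ‖³) numbers.  Counting the members
-- with witnesses in Zs along the structure of φ, with a factor c = (2‖φ‖)² per symbol (an ∃ has two symbols and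
-- c² > |Zs|), gives at most c^‖φ‖ = (2‖φ‖)^(2‖φ‖) representatives.
module Submission where

open import Defs
open import Data.Nat using (ℕ; zero; suc; _+_; _*_; _^_; _≤_; _<_; _⊔_; _∸_; _≡ᵇ_; _≟_; z≤n; s≤s; s≤s⁻¹; NonZero; >-nonZero)
open import Data.Nat.Properties
open import Data.Nat.Tactic.RingSolver using (solve-∀)

open import Data.Bool using (true; false; if_then_else_; _∨_; T)
open import Data.Fin using (Fin; zero; suc)
open import Data.Fin.Properties using (injective⇒≤)
open import Data.List using (List; []; _∷_; _++_; map; filter; concatMap; foldr; length; lookup; iterate; upTo; cartesianProduct)
open import Data.List.Properties using (length-++; length-map; length-filter; length-iterate; map-++)
open import Data.List.Membership.Propositional using (_∈_; _∉_; lose; find)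
open import Data.List.Membership.Propositional.Properties
  using (∈-++⁺ˡ; ∈-++⁺ʳ; ∈-++⁻; ∈-map⁺; ∈-map⁻; ∈-filter⁺; ∈-filter⁻; ∈-lookup; ∈-concatMap⁺; ∈-concatMap⁻;
         ∈-cartesianProduct⁺; ∈-cartesianProduct⁻; ∈-upTo⁺; ∈-upTo⁻)
open import Data.List.Membership.DecPropositional _≟_ using (_∈?_)
open import Data.List.Relation.Binary.Subset.Propositional using (_⊆_)
open import Data.List.Relation.Unary.All as All using (All; []; _∷_)
open import Data.List.Relation.Unary.All.Properties using () renaming (map⁺ to All-map⁺)
open import Data.List.Relation.Unary.Any as Any using (Any; here; there; any?)
open import Data.List.Relation.Unary.Any.Properties using (lookup-index)
open import Data.List.Relation.Unary.AllPairs using ([]; _∷_)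
open import Data.List.Relation.Unary.Unique.Propositional using (Unique)
open import Data.Product using (_×_; ∃-syntax; _,_; proj₁; proj₂; uncurry)
open import Data.Sum using (inj₁; inj₂; [_,_]′)
open import Data.Vec using (Vec; []; _∷_)
import Data.Vec as Vec
import Data.Vec.Properties as Vec
open import Function using (_∘_; id)
open import Function.Bundles using (_↔_; Inverse; Injection; mk↔ₛ′)
open import Function.Construct.Composition using (_↔-∘_)
open import Function.Construct.Identity using (↔-id)
open import Function.Construct.Symmetry using (↔-sym)
open import Function.Definitions using (Injective)
open import Function.Properties.Inverse using (↔⇒↣)
open import Relation.Binary.PropositionalEquality
open import Relation.Binary.Definitions using (tri<; tri≈; tri>)
open import Relation.Nullary using (¬_; Dec; yes; no; does; ¬?; contradiction)
open import Relation.Nullary.Decidable using (dec-true; dec-false; map′; _×-dec_; _→-dec_)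

unique⇒lookup-injective : ∀ {A : Set} {xs : List A} → Unique xs → Injective _≡_ _≡_ (lookup xs)
unique⇒lookup-injective (x≢ ∷ u) {zero}  {zero}  _ = refl
unique⇒lookup-injective (x≢ ∷ u) {zero}  {suc j} e = contradiction e (All.lookup x≢ (∈-lookup j))
unique⇒lookup-injective (x≢ ∷ u) {suc i} {zero}  e = contradiction (sym e) (All.lookup x≢ (∈-lookup i))
unique⇒lookup-injective (x≢ ∷ u) {suc i} {suc j} e = cong suc (unique⇒lookup-injective u e)

unique⊆⇒length≤ : ∀ {A : Set} {xs ys : List A} → Unique xs → xs ⊆ ys → length xs ≤ length ys
unique⊆⇒length≤ {xs = xs} {ys} u xs⊆ys = injective⇒≤ position-injective
  where
    position : Fin (length xs) → Fin (length ys)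
    position i = Any.index (xs⊆ys (∈-lookup i))

    lookup-position : ∀ i → lookup xs i ≡ lookup ys (position i)
    lookup-position i = lookup-index (xs⊆ys (∈-lookup i))

    position-injective : Injective _≡_ _≡_ position
    position-injective {i} {j} e = unique⇒lookup-injective u
      (trans (lookup-position i) (trans (cong (lookup ys) e) (sym (lookup-position j))))

iterate-suc-≥ : ∀ a k → All (a ≤_) (iterate suc a k)
iterate-suc-≥ a zero    = []
iterate-suc-≥ a (suc k) = ≤-refl ∷ All.map (≤-trans (n≤1+n a)) (iterate-suc-≥ (suc a) k)

iterate-suc-unique : ∀ a k → Unique (iterate suc a k)
iterate-suc-unique a zero    = []
iterate-suc-unique a (suc k) = All.map <⇒≢ (iterate-suc-≥ (suc a) k) ∷ iterate-suc-unique (suc a) k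

∈-iterate-suc : ∀ {a t} k → a ≤ t → t < a + k → t ∈ iterate suc a k
∈-iterate-suc {a} {t} zero    a≤t t<a+0 = contradiction a≤t (<⇒≱ (subst (t <_) (+-identityʳ a) t<a+0))
∈-iterate-suc {a} {t} (suc k) a≤t t<a+1+k with m≤n⇒m<n∨m≡n a≤t
... | inj₂ refl = here refl
... | inj₁ a<t  = there (∈-iterate-suc k a<t (subst (t <_) (+-suc a k) t<a+1+k))

length-concatMap-≤ : ∀ {A B : Set} (f : A → List B) {m} xs →
                     (∀ x → length (f x) ≤ m) → length (concatMap f xs) ≤ length xs * m
length-concatMap-≤ f []       _ = z≤n
length-concatMap-≤ f {m} (x ∷ xs) h = begin
  length (f x ++ concatMap f xs)       ≡⟨ length-++ (f x) ⟩
  length (f x) + length (concatMap f xs) ≤⟨ +-mono-≤ (h x) (length-concatMap-≤ f xs h) ⟩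
  m + length xs * m ∎
  where open ≤-Reasoning

length-cartesianProduct : ∀ {A B : Set} (xs : List A) (ys : List B) →
                          length (cartesianProduct xs ys) ≡ length xs * length ys
length-cartesianProduct []       ys = refl
length-cartesianProduct (x ∷ xs) ys = begin
  length (map (x ,_) ys ++ cartesianProduct xs ys)             ≡⟨ length-++ (map (x ,_) ys) ⟩
  length (map (x ,_) ys) + length (cartesianProduct xs ys)     ≡⟨ cong₂ _+_ (length-map (x ,_) ys) (length-cartesianProduct xs ys) ⟩
  length ys + length xs * length ys ∎
  where open ≡-Reasoning

suc-≤-* : ∀ {c x} → 2 ≤ c → 1 ≤ x → suc x ≤ c * x
suc-≤-* {c} {x} 2≤c 1≤x = begin
  suc x ≤⟨ +-monoˡ-≤ x 1≤x ⟩
  x + x ≡⟨ cong (x +_) (+-identityʳ x) ⟨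
  2 * x ≤⟨ *-monoˡ-≤ x 2≤c ⟩
  c * x ∎
  where open ≤-Reasoning

suc-+-≤-* : ∀ {c x y} → 3 ≤ c → 1 ≤ x → 1 ≤ y → suc (x + y) ≤ c * (x * y)
suc-+-≤-* {c} {x} {y} 3≤c 1≤x 1≤y = begin
  1 + (x + y)             ≤⟨ +-mono-≤ (*-mono-≤ 1≤x 1≤y)
                                      (+-mono-≤ (m≤m*n x y {{>-nonZero 1≤y}}) (m≤n*m y x {{>-nonZero 1≤x}})) ⟩
  x * y + (x * y + x * y) ≡⟨ cong (λ z → x * y + (x * y + z)) (+-identityʳ (x * y)) ⟨
  3 * (x * y)             ≤⟨ *-monoˡ-≤ (x * y) 3≤c ⟩
  c * (x * y) ∎
  where open ≤-Reasoning

suc-*-≤-* : ∀ {c t x} → suc t ≤ c * c → 1 ≤ x → suc (t * x) ≤ c * (c * x)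
suc-*-≤-* {c} {t} {x} 1+t≤c*c 1≤x = begin
  suc (t * x)   ≤⟨ +-monoˡ-≤ (t * x) 1≤x ⟩
  suc t * x     ≤⟨ *-monoˡ-≤ x 1+t≤c*c ⟩
  (c * c) * x   ≡⟨ *-assoc c c x ⟩
  c * (c * x) ∎
  where open ≤-Reasoning

≡ᵇ-false⇒≢ : ∀ {m n} → (m ≡ᵇ n) ≡ false → m ≢ n
≡ᵇ-false⇒≢ {m} {n} m≡ᵇn refl = subst T m≡ᵇn (≡⇒≡ᵇ m m refl)

+-square-≤-square : ∀ {a s x} → a < s → x ≤ a * a → s + x ≤ s * s
+-square-≤-square {a} {suc t} (s≤s a≤t) x≤a*a = +-monoʳ-≤ (suc t) (≤-trans x≤a*a (*-mono-≤ a≤t (m≤n⇒m≤1+n a≤t)))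

sum-of-squares-≤ : ∀ a b → a * a + b * b ≤ (a + b) * (a + b)
sum-of-squares-≤ a b = begin
  a * a + b * b             ≤⟨ +-mono-≤ (*-monoʳ-≤ a (m≤m+n a b)) (*-monoʳ-≤ b (m≤n+m b a)) ⟩
  a * (a + b) + b * (a + b) ≡⟨ *-distribʳ-+ (a + b) a b ⟨
  (a + b) * (a + b) ∎
  where open ≤-Reasoning

suc-square-≤ : ∀ a → suc (a * a) ≤ suc a * suc a
suc-square-≤ a = s≤s (≤-trans (*-monoʳ-≤ a (n≤1+n a)) (m≤n+m (a * suc a) a))

three≤square : ∀ {n} → 1 ≤ n → 3 ≤ (2 * n) ^ 2
three≤square {suc m} _ = ≤-trans (n≤1+n 3) (≤-trans (m≤m+n _ _) (≤-reflexive (expand m)))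
  where
    expand : ∀ m → 4 + (4 * (m * m) + 8 * m) ≡ 2 * suc m * (2 * suc m * 1)
    expand = solve-∀

nearby-count-≤ : ∀ {n} → 1 ≤ n → suc (suc n * (n * n + suc (n * n))) ≤ (2 * n) ^ 2 * (2 * n) ^ 2
nearby-count-≤ {suc m} _ = ≤-trans (m≤m+n _ _) (≤-reflexive (expand m))
  where
    expand : ∀ m → suc (suc (suc m) * (suc m * suc m + suc (suc m * suc m)))
                     + (16 * (m * m * m * m) + 62 * (m * m * m) + 88 * (m * m) + 53 * m + 9)
                   ≡ 2 * suc m * (2 * suc m * 1) * (2 * suc m * (2 * suc m * 1))
    expand = solve-∀

-- Exactly what a map needs in order to commute with `fresh` on lists inside U.
record RunPreservingOn (U : List ℕ) (f : ℕ → ℕ) : Set where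
  field
    monotone    : ∀ {a b} → a ∈ U → b ∈ U → a ≤ b → f a ≤ f b
    suc-commute : ∀ {m} → m ∈ U → suc m ∈ U → f (suc m) ≡ suc (f m)

RunPreservingOn-cong : ∀ {U f g} → (∀ {u} → u ∈ U → f u ≡ g u) → RunPreservingOn U f → RunPreservingOn U g
RunPreservingOn-cong f≗g f-runs = record
  { monotone    = λ a∈U b∈U a≤b → subst₂ _≤_ (f≗g a∈U) (f≗g b∈U) (monotone a∈U b∈U a≤b)
  ; suc-commute = λ m∈U 1+m∈U → trans (sym (f≗g 1+m∈U)) (trans (suc-commute m∈U 1+m∈U) (cong suc (f≗g m∈U)))
  }
  where open RunPreservingOn f-runs

maximum : List ℕ → ℕ
maximum = foldr _⊔_ 0

maximum-∈ : ∀ y ys → maximum (y ∷ ys) ∈ y ∷ ys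
maximum-∈ y []        = here (⊔-identityʳ y)
maximum-∈ y (y′ ∷ ys) with ⊔-sel y (maximum (y′ ∷ ys))
... | inj₁ y⊔m≡y = here y⊔m≡y
... | inj₂ y⊔m≡m = there (subst (_∈ y′ ∷ ys) (sym y⊔m≡m) (maximum-∈ y′ ys))

module _ {U : List ℕ} {f : ℕ → ℕ} (f-runs : RunPreservingOn U f) where
  open RunPreservingOn f-runs

  ⊔-commute : ∀ {a b} → a ∈ U → b ∈ U → f a ⊔ f b ≡ f (a ⊔ b)
  ⊔-commute {a} {b} a∈U b∈U with ≤-total a b
  ... | inj₁ a≤b = trans (m≤n⇒m⊔n≡n (monotone a∈U b∈U a≤b)) (cong f (sym (m≤n⇒m⊔n≡n a≤b)))
  ... | inj₂ b≤a = trans (m≥n⇒m⊔n≡m (monotone b∈U a∈U b≤a)) (cong f (sym (m≥n⇒m⊔n≡m b≤a)))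

  maximum-commute : ∀ {y ys} → y ∷ ys ⊆ U → maximum (map f (y ∷ ys)) ≡ f (maximum (y ∷ ys))
  maximum-commute {y} {[]}      _   = trans (⊔-identityʳ (f y)) (cong f (sym (⊔-identityʳ y)))
  maximum-commute {y} {y′ ∷ ys} ⊆U = trans (cong (f y ⊔_) (maximum-commute (⊆U ∘ there)))
                                           (⊔-commute (⊆U (here refl)) (⊆U (there (maximum-∈ y′ ys))))

-- Compressing a finite set of variables

Near : ℕ → List ℕ → ℕ → Set
Near K V t = Any (λ v → v ≤ t + K × t ≤ v + K) (0 ∷ V)

Near-mono : ∀ {K K′ V t} → K ≤ K′ → Near K V t → Near K′ V t
Near-mono K≤K′ = Any.map λ (v≤t+K , t≤v+K) → ≤-trans v≤t+K (+-monoʳ-≤ _ K≤K′) , ≤-trans t≤v+K (+-monoʳ-≤ _ K≤K′)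

window : ℕ → ℕ → List ℕ
window K v = iterate suc (v ∸ K) (K + suc K)

nearby : ℕ → List ℕ → List ℕ
nearby K V = concatMap (window K) (0 ∷ V)

∈-window : ∀ {K v t} → v ≤ t + K → t ≤ v + K → t ∈ window K v
∈-window {K} {v} {t} v≤t+K t≤v+K =
  ∈-iterate-suc (K + suc K) (m≤n+o⇒m∸n≤o v K (subst (v ≤_) (+-comm t K) v≤t+K)) (begin-strict
  t                         ≤⟨ t≤v+K ⟩
  v + K                     <⟨ +-monoʳ-< v (n<1+n K) ⟩
  v + suc K                 ≤⟨ +-monoˡ-≤ (suc K) (m≤n+m∸n v K) ⟩
  K + (v ∸ K) + suc K       ≡⟨ cong (_+ suc K) (+-comm K (v ∸ K)) ⟩
  (v ∸ K) + K + suc K       ≡⟨ +-assoc (v ∸ K) K (suc K) ⟩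
  (v ∸ K) + (K + suc K) ∎)
  where open ≤-Reasoning

∈-nearby : ∀ {K V t} → Near K V t → t ∈ nearby K V
∈-nearby {K} near with v , v∈ , (v≤t+K , t≤v+K) ← find near = ∈-concatMap⁺ (window K) (lose v∈ (∈-window v≤t+K t≤v+K))

length-nearby : ∀ K V → length (nearby K V) ≤ suc (length V) * (K + suc K)
length-nearby K V = length-concatMap-≤ (window K) (0 ∷ V) λ v → ≤-reflexive (length-iterate suc (v ∸ K) (K + suc K))

module Compression (U V : List ℕ) (V⊆U : V ⊆ U) where

  K : ℕ
  K = length U

  run-length : ∀ {s k} → All (_∈ U) (iterate suc s k) → k ≤ K
  run-length {s} {k} run = subst (_≤ K) (length-iterate suc s k) (unique⊆⇒length≤ (iterate-suc-unique s k) (All.lookup run))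

  -- s, s + 1, …, s + k ∈ U and s + k ∈ V; by run-length, searching only k < K loses nothing.
  Anchored : ℕ → Set
  Anchored s = Any (λ k → All (_∈ U) (iterate suc s (suc k)) × s + k ∈ V) (upTo K)

  anchored? : ∀ s → Dec (Anchored s)
  anchored? s = any? (λ k → All.all? (_∈? U) (iterate suc s (suc k)) ×-dec (s + k ∈? V)) (upTo K)

  anchored-V : ∀ {v} → v ∈ V → Anchored v
  anchored-V {v} v∈V = lose (∈-upTo⁺ (run-length (V⊆U v∈V ∷ []))) ((V⊆U v∈V ∷ []) , subst (_∈ V) (sym (+-identityʳ v)) v∈V)

  anchored-pred : ∀ {m} → m ∈ U → Anchored (suc m) → Anchored m
  anchored-pred {m} m∈U anchored with k , _ , (run , v∈V) ← find anchored =
    lose (∈-upTo⁺ (run-length (m∈U ∷ run))) ((m∈U ∷ run) , subst (_∈ V) (sym (+-suc m k)) v∈V)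

  Base : ℕ → Set
  Base b = Any (λ v → b ≤ v × v ≤ b + K) (0 ∷ V)

  anchored⇒base : ∀ {s} → Anchored s → Base s
  anchored⇒base {s} anchored with k , k∈ , (_ , s+k∈V) ← find anchored =
    there (lose s+k∈V (m≤m+n s k , +-monoʳ-≤ s (<⇒≤ (∈-upTo⁻ k∈))))

  base-near : ∀ {b j} → Base b → j ≤ K → Near K V (b + j)
  base-near {b} {j} base j≤K = Any.map
    (λ (b≤v , v≤b+K) → ≤-trans v≤b+K (+-monoˡ-≤ K (m≤m+n b j)) , +-mono-≤ b≤v j≤K ) base

  -- Anchored points stay where they are; every other element of U is moved to just after the image of the
  -- previous element of U (or to 0), which closes the gaps that do not end at an anchored point.
  opaque
    mutual
      compress : ℕ → ℕ
      compress s = if does (anchored? s) then s else next s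

      next : ℕ → ℕ
      next zero    = zero
      next (suc s) = if does (s ∈? U) then suc (compress s) else next s

    compress-anchored : ∀ {s} → Anchored s → compress s ≡ s
    compress-anchored {s} anchored = cong (if_then s else next s) (dec-true (anchored? s) anchored)

    compress-unanchored : ∀ {s} → ¬ Anchored s → compress s ≡ next s
    compress-unanchored {s} unanchored = cong (if_then s else next s) (dec-false (anchored? s) unanchored)

    next-zero : next zero ≡ zero
    next-zero = refl

    next-∈ : ∀ {s} → s ∈ U → next (suc s) ≡ suc (compress s)
    next-∈ {s} s∈U = cong (if_then suc (compress s) else next s) (dec-true (s ∈? U) s∈U)

    next-∉ : ∀ {s} → s ∉ U → next (suc s) ≡ next s
    next-∉ {s} s∉U = cong (if_then suc (compress s) else next s) (dec-false (s ∈? U) s∉U)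

  mutual
    compress-≤ : ∀ s → compress s ≤ s
    compress-≤ s with anchored? s
    ... | yes anchored   = ≤-reflexive (compress-anchored anchored)
    ... | no unanchored = ≤-trans (≤-reflexive (compress-unanchored unanchored)) (next-≤ s)

    next-≤ : ∀ s → next s ≤ s
    next-≤ zero = ≤-reflexive next-zero
    next-≤ (suc s) with s ∈? U
    ... | yes s∈U = ≤-trans (≤-reflexive (next-∈ s∈U)) (s≤s (compress-≤ s))
    ... | no s∉U  = ≤-trans (≤-reflexive (next-∉ s∉U)) (m≤n⇒m≤1+n (next-≤ s))

  next-≤-compress : ∀ s → next s ≤ compress s
  next-≤-compress s with anchored? s
  ... | yes anchored   = ≤-trans (next-≤ s) (≤-reflexive (sym (compress-anchored anchored)))
  ... | no unanchored = ≤-reflexive (sym (compress-unanchored unanchored))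

  next-≤-next-suc : ∀ s → next s ≤ next (suc s)
  next-≤-next-suc s with s ∈? U
  ... | yes s∈U = ≤-trans (m≤n⇒m≤1+n (next-≤-compress s)) (≤-reflexive (sym (next-∈ s∈U)))
  ... | no s∉U  = ≤-reflexive (sym (next-∉ s∉U))

  next-mono : ∀ {s t} → s ≤ t → next s ≤ next t
  next-mono {t = zero}  z≤n  = ≤-refl
  next-mono {s} {suc t} s≤1+t with m≤n⇒m<n∨m≡n s≤1+t
  ... | inj₂ refl  = ≤-refl
  ... | inj₁ s<1+t = ≤-trans (next-mono (s≤s⁻¹ s<1+t)) (next-≤-next-suc t)

  compress-mono-< : ∀ {a b} → a ∈ U → a < b → compress a < compress b
  compress-mono-< {a} {b} a∈U a<b = begin-strict
    compress a       <⟨ n<1+n (compress a) ⟩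
    suc (compress a) ≡⟨ next-∈ a∈U ⟨
    next (suc a)     ≤⟨ next-mono a<b ⟩
    next b           ≤⟨ next-≤-compress b ⟩
    compress b ∎
    where open ≤-Reasoning

  compress-injective : ∀ {a b} → a ∈ U → b ∈ U → compress a ≡ compress b → a ≡ b
  compress-injective {a} {b} a∈U b∈U ca≡cb with <-cmp a b
  ... | tri< a<b _ _ = contradiction ca≡cb (<⇒≢ (compress-mono-< a∈U a<b))
  ... | tri≈ _ a≡b _ = a≡b
  ... | tri> _ _ b<a = contradiction ca≡cb (>⇒≢ (compress-mono-< b∈U b<a))

  compress-suc : ∀ {m} → m ∈ U → compress (suc m) ≡ suc (compress m)
  compress-suc {m} m∈U with anchored? (suc m)
  ... | yes anchored   = trans (compress-anchored anchored) (cong suc (sym (compress-anchored (anchored-pred m∈U anchored))))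
  ... | no unanchored = trans (compress-unanchored unanchored) (next-∈ m∈U)

  compress-runs : RunPreservingOn U compress
  compress-runs = record
    { monotone    = λ {a} {b} a∈U _ a≤b → [ (λ a<b → <⇒≤ (compress-mono-< a∈U a<b)) , (λ { refl → ≤-refl }) ]′
                                            (m≤n⇒m<n∨m≡n a≤b)
    ; suc-commute = λ m∈U _ → compress-suc m∈U
    }

  compress-fixes-V : ∀ {v} → v ∈ V → compress v ≡ v
  compress-fixes-V = compress-anchored ∘ anchored-V

  record NextDecomposition (s : ℕ) : Set where
    field
      base          : ℕ
      base-ok       : Base base
      passed        : List ℕ
      passed-unique : Unique passed
      passed⊆U      : passed ⊆ U
      passed-below  : All (_< s) passed
      next≡         : next s ≡ base + length passed

  -- next s = b + #{elements of U in [b, s)}, for the last anchored b below s (or b = 0).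
  next-decomposition : ∀ s → NextDecomposition s
  next-decomposition zero = record
    { base = 0 ; base-ok = here (z≤n , z≤n) ; passed = [] ; passed-unique = []
    ; passed⊆U = λ () ; passed-below = [] ; next≡ = next-zero }
  next-decomposition (suc s) with s ∈? U | anchored? s
  ... | no s∉U | _ = record
    { base = base ; base-ok = base-ok ; passed = passed ; passed-unique = passed-unique ; passed⊆U = passed⊆U
    ; passed-below = All.map m<n⇒m<1+n passed-below ; next≡ = trans (next-∉ s∉U) next≡ }
    where open NextDecomposition (next-decomposition s)
  ... | yes s∈U | yes anchored = record
    { base = s ; base-ok = anchored⇒base anchored ; passed = s ∷ [] ; passed-unique = [] ∷ []
    ; passed⊆U = λ { (here refl) → s∈U } ; passed-below = n<1+n s ∷ []
    ; next≡ = trans (next-∈ s∈U) (trans (cong suc (compress-anchored anchored)) (+-comm 1 s)) }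
  ... | yes s∈U | no unanchored = record
    { base = base ; base-ok = base-ok ; passed = s ∷ passed
    ; passed-unique = All.map >⇒≢ passed-below ∷ passed-unique
    ; passed⊆U = λ { (here refl) → s∈U ; (there p∈) → passed⊆U p∈ }
    ; passed-below = n<1+n s ∷ All.map m<n⇒m<1+n passed-below
    ; next≡ = begin
        next (suc s)                 ≡⟨ next-∈ s∈U ⟩
        suc (compress s)             ≡⟨ cong suc (compress-unanchored unanchored) ⟩
        suc (next s)                 ≡⟨ cong suc next≡ ⟩
        suc (base + length passed)   ≡⟨ +-suc base (length passed) ⟨
        base + length (s ∷ passed) ∎ }
    where open NextDecomposition (next-decomposition s)
          open ≡-Reasoning

  next-near : ∀ s → Near K V (next s)
  next-near s = subst (Near K V) (sym next≡) (base-near base-ok (unique⊆⇒length≤ passed-unique passed⊆U))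
    where open NextDecomposition (next-decomposition s)

  compress-near : ∀ s → Near K V (compress s)
  compress-near s with anchored? s
  ... | yes anchored   = subst (Near K V) (trans (+-identityʳ s) (sym (compress-anchored anchored)))
                                 (base-near (anchored⇒base anchored) z≤n)
  ... | no unanchored = subst (Near K V) (sym (compress-unanchored unanchored)) (next-near s)

-- Extending a finite injection to a bijection

transpose : ℕ → ℕ → ℕ → ℕ
transpose a b x with x ≟ a
... | yes _ = b
... | no _ with x ≟ b
...   | yes _ = a
...   | no _  = x

transpose-a : ∀ a b → transpose a b a ≡ b
transpose-a a b with a ≟ a
... | yes _   = refl
... | no a≢a = contradiction refl a≢a

transpose-b : ∀ a b → transpose a b b ≡ a
transpose-b a b with b ≟ a
... | yes refl = refl
... | no _ with b ≟ b
...   | yes _   = refl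
...   | no b≢b = contradiction refl b≢b

transpose-other : ∀ {a b x} → x ≢ a → x ≢ b → transpose a b x ≡ x
transpose-other {a} {b} {x} x≢a x≢b with x ≟ a
... | yes x≡a = contradiction x≡a x≢a
... | no _ with x ≟ b
...   | yes x≡b = contradiction x≡b x≢b
...   | no _    = refl

transpose-involutive : ∀ a b x → transpose a b (transpose a b x) ≡ x
transpose-involutive a b x with x ≟ a
... | yes refl = transpose-b x b
... | no x≢a with x ≟ b
...   | yes refl = transpose-a a x
...   | no x≢b   = transpose-other x≢a x≢b

transposition : ℕ → ℕ → ℕ ↔ ℕ
transposition a b = mk↔ₛ′ (transpose a b) (transpose a b) (transpose-involutive a b) (transpose-involutive a b)

extend-to-bijection : ∀ (f : ℕ → ℕ) U → (∀ {a b} → a ∈ U → b ∈ U → f a ≡ f b → a ≡ b) →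
                      ∃[ π ] ∀ {u} → u ∈ U → Inverse.to π u ≡ f u
extend-to-bijection f []      _     = ↔-id ℕ , λ ()
extend-to-bijection f (s ∷ U) f-inj
  with π , π≗f ← extend-to-bijection f U (λ a∈U b∈U → f-inj (there a∈U) (there b∈U))
  with Inverse.to π s ≟ f s
... | yes πs≡fs = π , λ { (here refl) → πs≡fs ; (there u∈U) → π≗f u∈U }
... | no πs≢fs  = transposition (Inverse.to π s) (f s) ↔-∘ π ,
                  λ { (here refl) → transpose-a (Inverse.to π s) (f s) ; (there u∈U) → unmoved u∈U }
  where
    u≢s : ∀ {u} → u ∈ U → u ≢ s
    u≢s u∈U refl = πs≢fs (π≗f u∈U)

    unmoved : ∀ {u} → u ∈ U → transpose (Inverse.to π s) (f s) (Inverse.to π u) ≡ f u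
    unmoved u∈U = trans (cong (transpose _ _) (π≗f u∈U)) (transpose-other
      (λ fu≡πs → u≢s u∈U (Injection.injective (↔⇒↣ π) (trans (π≗f u∈U) fu≡πs)))
      (λ fu≡fs → u≢s u∈U (f-inj (there u∈U) (here refl) fu≡fs)))

-- Renaming the variables of formulas

module _ {Sg : Signature} where

  mapVarsᵍ : (Var → Var) → Guard Sg → Guard Sg
  mapVarsᵍ P (atom R xs) = atom R (Vec.map P xs)
  mapVarsᵍ P (eq x y)    = eq (P x) (P y)
  mapVarsᵍ P (gex y α)   = gex (P y) (mapVarsᵍ P α)

  mapVars : (Var → Var) → Form Sg → Form Sg
  mapVars P (grd α)    = grd (mapVarsᵍ P α)
  mapVars P (or φ ψ)   = or (mapVars P φ) (mapVars P ψ)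
  mapVars P (and φ ψ)  = and (mapVars P φ) (mapVars P ψ)
  mapVars P (ex x φ)   = ex (P x) (mapVars P φ)
  mapVars P (gneg α φ) = gneg (mapVarsᵍ P α) (mapVars P φ)

  varsᵍ : Guard Sg → List Var
  varsᵍ (atom R xs) = Vec.toList xs
  varsᵍ (eq x y)    = x ∷ y ∷ []
  varsᵍ (gex y α)   = y ∷ varsᵍ α

  vars : Form Sg → List Var
  vars (grd α)    = varsᵍ α
  vars (or φ ψ)   = vars φ ++ vars ψ
  vars (and φ ψ)  = vars φ ++ vars ψ
  vars (ex x φ)   = x ∷ vars φ
  vars (gneg α φ) = varsᵍ α ++ vars φ

  remove-⊆ : ∀ y L → remove {Sg} y L ⊆ L
  remove-⊆ y L = proj₁ ∘ ∈-filter⁻ (λ v → ¬? (v ≟ y))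

  ∈-remove⁺ : ∀ {v y L} → v ∈ L → v ≢ y → v ∈ remove {Sg} y L
  ∈-remove⁺ {y = y} = ∈-filter⁺ (λ v → ¬? (v ≟ y))

  FVᵍ⊆varsᵍ : ∀ α → FVg α ⊆ varsᵍ α
  FVᵍ⊆varsᵍ (atom R xs) = id
  FVᵍ⊆varsᵍ (eq x y)    = id
  FVᵍ⊆varsᵍ (gex y α)   = there ∘ FVᵍ⊆varsᵍ α ∘ remove-⊆ y (FVg α)

  ++-⊆ : ∀ {xs ys xs′ ys′ : List Var} → xs ⊆ xs′ → ys ⊆ ys′ → xs ++ ys ⊆ xs′ ++ ys′
  ++-⊆ {xs} {xs′ = xs′} p q v∈ with ∈-++⁻ xs v∈
  ... | inj₁ v∈xs = ∈-++⁺ˡ (p v∈xs)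
  ... | inj₂ v∈ys = ∈-++⁺ʳ xs′ (q v∈ys)

  FV⊆vars : ∀ φ → FVf φ ⊆ vars φ
  FV⊆vars (grd α)    = FVᵍ⊆varsᵍ α
  FV⊆vars (or φ ψ)   = ++-⊆ (FV⊆vars φ) (FV⊆vars ψ)
  FV⊆vars (and φ ψ)  = ++-⊆ (FV⊆vars φ) (FV⊆vars ψ)
  FV⊆vars (ex x φ)   = there ∘ FV⊆vars φ ∘ remove-⊆ x (FVf φ)
  FV⊆vars (gneg α φ) = ++-⊆ (FVᵍ⊆varsᵍ α) (FV⊆vars φ)

  sizeᵍ-reng : ∀ ρ α → sizeg (reng {Sg} ρ α) ≡ sizeg α
  sizeᵍ-reng ρ (atom R xs) = refl
  sizeᵍ-reng ρ (eq x y)    = refl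
  sizeᵍ-reng ρ (gex y α)   = cong (2 +_) (sizeᵍ-reng _ α)

  size-renf : ∀ ρ φ → size (renf {Sg} ρ φ) ≡ size φ
  size-renf ρ (grd α)    = sizeᵍ-reng ρ α
  size-renf ρ (or φ ψ)   = cong suc (cong₂ _+_ (size-renf ρ φ) (size-renf ρ ψ))
  size-renf ρ (and φ ψ)  = cong suc (cong₂ _+_ (size-renf ρ φ) (size-renf ρ ψ))
  size-renf ρ (ex x φ)   = cong (2 +_) (size-renf _ φ)
  size-renf ρ (gneg α φ) = cong (2 +_) (cong₂ _+_ (sizeᵍ-reng ρ α) (size-renf ρ φ))

  mapVarsᵍ-fixes : ∀ {P} α → (∀ {v} → v ∈ varsᵍ α → P v ≡ v) → mapVarsᵍ P α ≡ α
  mapVarsᵍ-fixes (atom R xs) fix = cong (atom R) (map-fixes xs fix)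
    where
      map-fixes : ∀ {P n} (xs : Vec Var n) → (∀ {v} → v ∈ Vec.toList xs → P v ≡ v) → Vec.map P xs ≡ xs
      map-fixes []       fix = refl
      map-fixes (x ∷ xs) fix = cong₂ _∷_ (fix (here refl)) (map-fixes xs (fix ∘ there))
  mapVarsᵍ-fixes (eq x y)    fix = cong₂ eq (fix (here refl)) (fix (there (here refl)))
  mapVarsᵍ-fixes (gex y α)   fix = cong₂ gex (fix (here refl)) (mapVarsᵍ-fixes α (fix ∘ there))

  mapVars-fixes : ∀ {P} φ → (∀ {v} → v ∈ vars φ → P v ≡ v) → mapVars P φ ≡ φ
  mapVars-fixes (grd α)    fix = cong grd (mapVarsᵍ-fixes α fix)
  mapVars-fixes (or φ ψ)   fix = cong₂ or (mapVars-fixes φ (fix ∘ ∈-++⁺ˡ)) (mapVars-fixes ψ (fix ∘ ∈-++⁺ʳ (vars φ)))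
  mapVars-fixes (and φ ψ)  fix = cong₂ and (mapVars-fixes φ (fix ∘ ∈-++⁺ˡ)) (mapVars-fixes ψ (fix ∘ ∈-++⁺ʳ (vars φ)))
  mapVars-fixes (ex x φ)   fix = cong₂ ex (fix (here refl)) (mapVars-fixes φ (fix ∘ there))
  mapVars-fixes (gneg α φ) fix = cong₂ gneg (mapVarsᵍ-fixes α (fix ∘ ∈-++⁺ˡ)) (mapVars-fixes φ (fix ∘ ∈-++⁺ʳ (varsᵍ α)))

  module _ {f g : Var → Var} (f∘g≗id : ∀ v → f (g v) ≡ v) where

    rt-inverse : ∀ t → rt {Sg} f (rt g t) ≡ t
    rt-inverse (fr v) = cong fr (f∘g≗id v)
    rt-inverse (bd i) = refl

    nrg-inverse : ∀ α → nrg {Sg} f (nrg g α) ≡ α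
    nrg-inverse (natom R ts) = cong (natom R) (begin
      Vec.map (rt f) (Vec.map (rt g) ts) ≡⟨ Vec.map-∘ (rt f) (rt g) ts ⟨
      Vec.map (rt f ∘ rt g) ts           ≡⟨ Vec.map-cong rt-inverse ts ⟩
      Vec.map id ts                      ≡⟨ Vec.map-id ts ⟩
      ts ∎)
      where open ≡-Reasoning
    nrg-inverse (neq s t)    = cong₂ neq (rt-inverse s) (rt-inverse t)
    nrg-inverse (ngex α)     = cong ngex (nrg-inverse α)

    nrf-inverse : ∀ φ → nrf {Sg} f (nrf g φ) ≡ φ
    nrf-inverse (ngrd α)    = cong ngrd (nrg-inverse α)
    nrf-inverse (nor φ ψ)   = cong₂ nor (nrf-inverse φ) (nrf-inverse ψ)
    nrf-inverse (nand φ ψ)  = cong₂ nand (nrf-inverse φ) (nrf-inverse ψ)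
    nrf-inverse (nex φ)     = cong nex (nrf-inverse φ)
    nrf-inverse (ngneg α φ) = cong₂ ngneg (nrg-inverse α) (nrf-inverse φ)

  module _ {P : Var → Var} (P-inj : Injective _≡_ _≡_ P) where

    ≡ᵇ-injective : ∀ a b → (P a ≡ᵇ P b) ≡ (a ≡ᵇ b)
    ≡ᵇ-injective a b with a ≟ b
    ... | yes refl = trans (dec-true (P a ≟ P a) refl) (sym (dec-true (a ≟ a) refl))
    ... | no a≢b   = trans (dec-false (P a ≟ P b) (a≢b ∘ P-inj)) (sym (dec-false (a ≟ b) a≢b))

    remove-map : ∀ y L → remove {Sg} (P y) (map P L) ≡ map P (remove {Sg} y L)
    remove-map y []      = refl
    remove-map y (v ∷ L) rewrite ≡ᵇ-injective v y with v ≡ᵇ y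
    ... | true  = remove-map y L
    ... | false = cong (P v ∷_) (remove-map y L)

    FVᵍ-mapVars : ∀ α → FVg (mapVarsᵍ P α) ≡ map P (FVg α)
    FVᵍ-mapVars (atom R xs) = Vec.toList-map P xs
    FVᵍ-mapVars (eq x y)    = refl
    FVᵍ-mapVars (gex y α)   = trans (cong (remove {Sg} (P y)) (FVᵍ-mapVars α)) (remove-map y (FVg α))

    FV-mapVars : ∀ φ → FVf (mapVars P φ) ≡ map P (FVf φ)
    FV-mapVars (grd α)    = FVᵍ-mapVars α
    FV-mapVars (or φ ψ)   = trans (cong₂ _++_ (FV-mapVars φ) (FV-mapVars ψ)) (sym (map-++ P (FVf φ) (FVf ψ)))
    FV-mapVars (and φ ψ)  = trans (cong₂ _++_ (FV-mapVars φ) (FV-mapVars ψ)) (sym (map-++ P (FVf φ) (FVf ψ)))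
    FV-mapVars (ex x φ)   = trans (cong (remove {Sg} (P x)) (FV-mapVars φ)) (remove-map x (FVf φ))
    FV-mapVars (gneg α φ) = trans (cong₂ _++_ (FVᵍ-mapVars α) (FV-mapVars φ)) (sym (map-++ P (FVg α) (FVf φ)))

    FVs-mapVars : ∀ Γ → FVs (map (mapVars P) Γ) ≡ map P (FVs Γ)
    FVs-mapVars []      = refl
    FVs-mapVars (φ ∷ Γ) = trans (cong₂ _++_ (FV-mapVars φ) (FVs-mapVars Γ)) (sym (map-++ P (FVf φ) (FVs Γ)))

    var-map : ∀ env x → var {Sg} (map P env) (P x) ≡ rt P (var env x)
    var-map []        x = refl
    var-map (y ∷ env) x rewrite ≡ᵇ-injective x y with x ≡ᵇ y
    ... | true  = refl
    ... | false = trans (cong bump (var-map env x)) (bump-rt (var env x))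
      where
        bump-rt : ∀ t → bump (rt P t) ≡ rt P (bump t)
        bump-rt (fr v) = refl
        bump-rt (bd i) = refl

    nlg-mapVars : ∀ env α → nlg (map P env) (mapVarsᵍ P α) ≡ nrg P (nlg env α)
    nlg-mapVars env (atom R xs) = cong (natom R) (begin
      Vec.map (var (map P env)) (Vec.map P xs) ≡⟨ Vec.map-∘ (var (map P env)) P xs ⟨
      Vec.map (var (map P env) ∘ P) xs         ≡⟨ Vec.map-cong (var-map env) xs ⟩
      Vec.map (rt P ∘ var env) xs              ≡⟨ Vec.map-∘ (rt P) (var env) xs ⟩
      Vec.map (rt P) (Vec.map (var env) xs) ∎)
      where open ≡-Reasoning
    nlg-mapVars env (eq x y)    = cong₂ neq (var-map env x) (var-map env y)
    nlg-mapVars env (gex y α)   = cong ngex (nlg-mapVars (y ∷ env) α)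

    nlf-mapVars : ∀ env φ → nlf (map P env) (mapVars P φ) ≡ nrf P (nlf env φ)
    nlf-mapVars env (grd α)    = cong ngrd (nlg-mapVars env α)
    nlf-mapVars env (or φ ψ)   = cong₂ nor (nlf-mapVars env φ) (nlf-mapVars env ψ)
    nlf-mapVars env (and φ ψ)  = cong₂ nand (nlf-mapVars env φ) (nlf-mapVars env ψ)
    nlf-mapVars env (ex x φ)   = cong nex (nlf-mapVars (x ∷ env) φ)
    nlf-mapVars env (gneg α φ) = cong₂ ngneg (nlg-mapVars env α) (nlf-mapVars env φ)

  module Commute {P : Var → Var} (P-inj : Injective _≡_ _≡_ P) {U : List Var} (P-runs : RunPreservingOn U P) where

    Intertwines : (Var → Var) → (Var → Var) → List Var → Set
    Intertwines ρ ρ′ xs = ∀ {v} → v ∈ xs → ρ′ (P v) ≡ P (ρ v)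

    MapsInto : (Var → Var) → List Var → Set
    MapsInto ρ xs = ∀ {v} → v ∈ xs → ρ v ∈ U

    fresh-map : ∀ {y ys} → y ∷ ys ⊆ U → fresh {Sg} (y ∷ ys) ∈ U → fresh {Sg} (map P (y ∷ ys)) ≡ P (fresh {Sg} (y ∷ ys))
    fresh-map {y} {ys} ⊆U fresh∈U =
      trans (cong suc (maximum-commute P-runs ⊆U)) (sym (suc-commute (⊆U (maximum-∈ y ys)) fresh∈U))
      where open RunPreservingOn P-runs

    occurs-map : ∀ y L → occurs {Sg} (P y) (map P L) ≡ occurs {Sg} y L
    occurs-map y []      = refl
    occurs-map y (v ∷ L) = cong₂ _∨_ (≡ᵇ-injective P-inj y v) (occurs-map y L)

    -- pick ρ y fv unfolds to choose y (map ρ fv).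
    choose : Var → List Var → Var
    choose y M = if occurs {Sg} y M then fresh {Sg} (y ∷ M) else y

    choose-map : ∀ y M → y ∷ M ⊆ U → choose y M ∈ U → choose (P y) (map P M) ≡ P (choose y M)
    choose-map y M ⊆U choice∈U rewrite occurs-map y M with occurs {Sg} y M
    ... | true  = fresh-map ⊆U choice∈U
    ... | false = refl

    pick-binder : ∀ {ρ ρ′ y body} → let fv = remove {Sg} y body in
                  Intertwines ρ ρ′ fv → MapsInto ρ fv → y ∈ U → pick {Sg} ρ y fv ∈ U →
                  pick {Sg} ρ′ (P y) (remove {Sg} (P y) (map P body)) ≡ P (pick {Sg} ρ y fv)
    pick-binder {ρ} {ρ′} {y} {body} ι into y∈U pick∈U = begin
      choose (P y) (map ρ′ (remove {Sg} (P y) (map P body))) ≡⟨ cong (choose (P y) ∘ map ρ′) (remove-map P-inj y body) ⟩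
      choose (P y) (map ρ′ (map P fv))                       ≡⟨ cong (choose (P y)) (map-intertwines fv ι) ⟩
      choose (P y) (map P (map ρ fv))                        ≡⟨ choose-map y (map ρ fv) ⊆U pick∈U ⟩
      P (pick {Sg} ρ y fv) ∎
      where
        open ≡-Reasoning
        fv = remove {Sg} y body

        map-intertwines : ∀ xs → Intertwines ρ ρ′ xs → map ρ′ (map P xs) ≡ map P (map ρ xs)
        map-intertwines []       ι = refl
        map-intertwines (x ∷ xs) ι = cong₂ _∷_ (ι (here refl)) (map-intertwines xs (ι ∘ there))

        ⊆U : y ∷ map ρ fv ⊆ U
        ⊆U (here refl) = y∈U
        ⊆U (there v∈)  with v , v∈fv , refl ← ∈-map⁻ ρ v∈ = into v∈fv

    upd-intertwines : ∀ {ρ ρ′ y w body} → Intertwines ρ ρ′ (remove {Sg} y body) →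
                      Intertwines (upd {Sg} ρ y w) (upd {Sg} ρ′ (P y) (P w)) body
    upd-intertwines {y = y} ι {v} v∈ rewrite ≡ᵇ-injective P-inj v y with v ≡ᵇ y in v≡ᵇy
    ... | true  = refl
    ... | false = ι (∈-remove⁺ v∈ (≡ᵇ-false⇒≢ v≡ᵇy))

    upd-into : ∀ {ρ y w body} → MapsInto ρ (remove {Sg} y body) → w ∈ U → MapsInto (upd {Sg} ρ y w) body
    upd-into {y = y} into w∈U {v} v∈ with v ≡ᵇ y in v≡ᵇy
    ... | true  = w∈U
    ... | false = into (∈-remove⁺ v∈ (≡ᵇ-false⇒≢ v≡ᵇy))

    mapVarsᵍ-reng : ∀ α {ρ ρ′} → Intertwines ρ ρ′ (FVg α) → MapsInto ρ (FVg α) →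
                    varsᵍ α ⊆ U → varsᵍ (reng ρ α) ⊆ U → mapVarsᵍ P (reng ρ α) ≡ reng ρ′ (mapVarsᵍ P α)
    mapVarsᵍ-reng (atom R xs) ι _ _ _ = cong (atom R) (map-intertwines xs ι)
      where
        map-intertwines : ∀ {n ρ ρ′} (xs : Vec Var n) → Intertwines ρ ρ′ (Vec.toList xs) →
                          Vec.map P (Vec.map ρ xs) ≡ Vec.map ρ′ (Vec.map P xs)
        map-intertwines []       ι = refl
        map-intertwines (x ∷ xs) ι = cong₂ _∷_ (sym (ι (here refl))) (map-intertwines xs (ι ∘ there))
    mapVarsᵍ-reng (eq x y) ι _ _ _ = cong₂ eq (sym (ι (here refl))) (sym (ι (there (here refl))))
    mapVarsᵍ-reng (gex y α) {ρ} {ρ′} ι into α⊆U ρα⊆U =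
      trans (cong (gex (P w)) (mapVarsᵍ-reng α (upd-intertwines {ρ} {ρ′} {y} {w} {FVg α} ι)
                                              (upd-into {ρ} {y} {w} {FVg α} into (ρα⊆U (here refl)))
                                              (α⊆U ∘ there) (ρα⊆U ∘ there)))
            (cong (λ u → gex u (reng (upd {Sg} ρ′ (P y) u) (mapVarsᵍ P α))) (sym w′≡Pw))
      where
        w = pick {Sg} ρ y (remove {Sg} y (FVg α))
        w′≡Pw : pick {Sg} ρ′ (P y) (FVg (gex (P y) (mapVarsᵍ P α))) ≡ P w
        w′≡Pw = trans (cong (pick {Sg} ρ′ (P y) ∘ remove {Sg} (P y)) (FVᵍ-mapVars P-inj α))
                      (pick-binder {ρ} {ρ′} {y} {FVg α} ι into (α⊆U (here refl)) (ρα⊆U (here refl)))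

    mapVars-renf : ∀ φ {ρ ρ′} → Intertwines ρ ρ′ (FVf φ) → MapsInto ρ (FVf φ) →
                   vars φ ⊆ U → vars (renf ρ φ) ⊆ U → mapVars P (renf ρ φ) ≡ renf ρ′ (mapVars P φ)
    mapVars-renf (grd α) ι into φ⊆U ρφ⊆U = cong grd (mapVarsᵍ-reng α ι into φ⊆U ρφ⊆U)
    mapVars-renf (or φ ψ) {ρ} ι into φ⊆U ρφ⊆U = cong₂ or
      (mapVars-renf φ (ι ∘ ∈-++⁺ˡ) (into ∘ ∈-++⁺ˡ) (φ⊆U ∘ ∈-++⁺ˡ) (ρφ⊆U ∘ ∈-++⁺ˡ))
      (mapVars-renf ψ (ι ∘ ∈-++⁺ʳ (FVf φ)) (into ∘ ∈-++⁺ʳ (FVf φ)) (φ⊆U ∘ ∈-++⁺ʳ (vars φ)) (ρφ⊆U ∘ ∈-++⁺ʳ (vars (renf ρ φ))))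
    mapVars-renf (and φ ψ) {ρ} ι into φ⊆U ρφ⊆U = cong₂ and
      (mapVars-renf φ (ι ∘ ∈-++⁺ˡ) (into ∘ ∈-++⁺ˡ) (φ⊆U ∘ ∈-++⁺ˡ) (ρφ⊆U ∘ ∈-++⁺ˡ))
      (mapVars-renf ψ (ι ∘ ∈-++⁺ʳ (FVf φ)) (into ∘ ∈-++⁺ʳ (FVf φ)) (φ⊆U ∘ ∈-++⁺ʳ (vars φ)) (ρφ⊆U ∘ ∈-++⁺ʳ (vars (renf ρ φ))))
    mapVars-renf (gneg α φ) {ρ} ι into φ⊆U ρφ⊆U = cong₂ gneg
      (mapVarsᵍ-reng α (ι ∘ ∈-++⁺ˡ) (into ∘ ∈-++⁺ˡ) (φ⊆U ∘ ∈-++⁺ˡ) (ρφ⊆U ∘ ∈-++⁺ˡ))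
      (mapVars-renf φ (ι ∘ ∈-++⁺ʳ (FVg α)) (into ∘ ∈-++⁺ʳ (FVg α)) (φ⊆U ∘ ∈-++⁺ʳ (varsᵍ α)) (ρφ⊆U ∘ ∈-++⁺ʳ (varsᵍ (reng ρ α))))
    mapVars-renf (ex y φ) {ρ} {ρ′} ι into φ⊆U ρφ⊆U =
      trans (cong (ex (P w)) (mapVars-renf φ (upd-intertwines {ρ} {ρ′} {y} {w} {FVf φ} ι)
                                            (upd-into {ρ} {y} {w} {FVf φ} into (ρφ⊆U (here refl)))
                                            (φ⊆U ∘ there) (ρφ⊆U ∘ there)))
            (cong (λ u → ex u (renf (upd {Sg} ρ′ (P y) u) (mapVars P φ))) (sym w′≡Pw))
      where
        w = pick {Sg} ρ y (remove {Sg} y (FVf φ))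
        w′≡Pw : pick {Sg} ρ′ (P y) (FVf (ex (P y) (mapVars P φ))) ≡ P w
        w′≡Pw = trans (cong (pick {Sg} ρ′ (P y) ∘ remove {Sg} (P y)) (FV-mapVars P-inj φ))
                      (pick-binder {ρ} {ρ′} {y} {FVf φ} ι into (φ⊆U (here refl)) (ρφ⊆U (here refl)))

    mapVars-[/] : ∀ C x z → vars C ⊆ U → z ∈ U → vars (C [ z / x ]) ⊆ U →
                  mapVars P (C [ z / x ]) ≡ mapVars P C [ P z / P x ]
    mapVars-[/] C x z C⊆U z∈U C[z/x]⊆U =
      mapVars-renf C (upd-intertwines {id} {id} {x} {z} {FVf C} λ _ → refl)
                     (upd-into {id} {x} {z} {FVf C} (C⊆U ∘ FV⊆vars C ∘ remove-⊆ x (FVf C)) z∈U) C⊆U C[z/x]⊆U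

  -- Enumerating the closure

  sizeᵍ-pos : ∀ α → 1 ≤ sizeg {Sg} α
  sizeᵍ-pos (atom R xs) = s≤s z≤n
  sizeᵍ-pos (eq x y)    = s≤s z≤n
  sizeᵍ-pos (gex y α)   = s≤s z≤n

  size-pos : ∀ φ → 1 ≤ size {Sg} φ
  size-pos (grd α)    = sizeᵍ-pos α
  size-pos (or φ ψ)   = s≤s z≤n
  size-pos (and φ ψ)  = s≤s z≤n
  size-pos (ex x φ)   = s≤s z≤n
  size-pos (gneg α φ) = s≤s z≤n

  Compatible : Form Sg → Form Sg → List (Form Sg) → List (Form Sg) → Set
  Compatible φ ψ Γ Δ = ∀ v → v ∈ FVs Γ → v ∈ FVs Δ → v ∈ FVf φ × v ∈ FVf ψ

  compatible? : ∀ φ ψ Γ Δ → Dec (Compatible φ ψ Γ Δ)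
  compatible? φ ψ Γ Δ = map′ (λ all v → All.lookup all) (λ compat → All.tabulate (compat _))
    (All.all? (λ v → (v ∈? FVs Δ) →-dec ((v ∈? FVf φ) ×-dec (v ∈? FVf ψ))) (FVs Γ))

  length-varsᵍ : ∀ α → length (varsᵍ α) ≤ sizeg {Sg} α
  length-varsᵍ (atom R xs) = ≤-trans (≤-reflexive (Vec.length-toList xs)) (n≤1+n _)
  length-varsᵍ (eq x y)    = n≤1+n 2
  length-varsᵍ (gex y α)   = s≤s (m≤n⇒m≤1+n (length-varsᵍ α))

  length-vars : ∀ φ → length (vars φ) ≤ size {Sg} φ
  length-vars (grd α)    = length-varsᵍ α
  length-vars (or φ ψ)   = m≤n⇒m≤1+n (≤-trans (≤-reflexive (length-++ (vars φ))) (+-mono-≤ (length-vars φ) (length-vars ψ)))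
  length-vars (and φ ψ)  = m≤n⇒m≤1+n (≤-trans (≤-reflexive (length-++ (vars φ))) (+-mono-≤ (length-vars φ) (length-vars ψ)))
  length-vars (ex x φ)   = s≤s (m≤n⇒m≤1+n (length-vars φ))
  length-vars (gneg α φ) = m≤n⇒m≤1+n (m≤n⇒m≤1+n
    (≤-trans (≤-reflexive (length-++ (varsᵍ α))) (+-mono-≤ (length-varsᵍ α) (length-vars φ))))

  mutual
    usedVars : ∀ {φ Γ} → Cl φ Γ → List Var
    usedVars {φ} d = vars φ ++ premiseVars d

    premiseVars : ∀ {φ Γ} → Cl φ Γ → List Var
    premiseVars (cl-orˡ d)      = usedVars d
    premiseVars (cl-orʳ d)      = usedVars d
    premiseVars (cl-and₂ d e _) = usedVars d ++ usedVars e
    premiseVars (cl-ex₂ z _ d)  = z ∷ usedVars d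
    premiseVars (cl-gneg₂ d)    = usedVars d
    premiseVars _               = []

  mutual
    length-usedVars : ∀ {φ Γ} (d : Cl φ Γ) → length (usedVars d) ≤ size φ * size φ
    length-usedVars {φ} d with a , a<size , premises≤ ← length-premiseVars d = begin
      length (vars φ ++ premiseVars d)         ≡⟨ length-++ (vars φ) ⟩
      length (vars φ) + length (premiseVars d) ≤⟨ +-monoˡ-≤ _ (length-vars φ) ⟩
      size φ + length (premiseVars d)          ≤⟨ +-square-≤-square a<size premises≤ ⟩
      size φ * size φ ∎
      where open ≤-Reasoning

    length-premiseVars : ∀ {φ Γ} (d : Cl φ Γ) → ∃[ a ] a < size φ × length (premiseVars d) ≤ a * a
    length-premiseVars {φ} cl-grd   = 0 , size-pos φ , z≤n
    length-premiseVars {φ} cl-empty = 0 , size-pos φ , z≤n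
    length-premiseVars {φ} cl-or    = 0 , size-pos φ , z≤n
    length-premiseVars {φ} cl-and   = 0 , size-pos φ , z≤n
    length-premiseVars {φ} cl-ex    = 0 , size-pos φ , z≤n
    length-premiseVars {φ} cl-gneg  = 0 , size-pos φ , z≤n
    length-premiseVars {or φ ψ} (cl-orˡ d) = size φ , s≤s (m≤m+n _ _) , length-usedVars d
    length-premiseVars {or φ ψ} (cl-orʳ d) = size ψ , s≤s (m≤n+m _ _) , length-usedVars d
    length-premiseVars {and φ ψ} (cl-and₂ d e _) = size φ + size ψ , ≤-refl , (begin
      length (usedVars d ++ usedVars e)                 ≡⟨ length-++ (usedVars d) ⟩
      length (usedVars d) + length (usedVars e)         ≤⟨ +-mono-≤ (length-usedVars d) (length-usedVars e) ⟩
      size φ * size φ + size ψ * size ψ                 ≤⟨ sum-of-squares-≤ (size φ) (size ψ) ⟩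
      (size φ + size ψ) * (size φ + size ψ) ∎)
      where open ≤-Reasoning
    length-premiseVars {ex x C} (cl-ex₂ z _ d) = suc (size C) , ≤-refl , (begin
      suc (length (usedVars d))       ≤⟨ s≤s (length-usedVars d) ⟩
      suc (size C′ * size C′)         ≡⟨ cong (λ k → suc (k * k)) (size-renf _ C) ⟩
      suc (size C * size C)           ≤⟨ suc-square-≤ (size C) ⟩
      suc (size C) * suc (size C) ∎)
      where
        open ≤-Reasoning
        C′ = C [ z / x ]
    length-premiseVars {gneg α C} (cl-gneg₂ d) = size C , s≤s (m≤n⇒m≤1+n (m≤n+m _ _)) , length-usedVars d

  module Enumeration (Zs : List Var) where

    witnesses : Form Sg → List Var
    witnesses C = filter (λ z → ¬? (z ∈? FVf C)) Zs

    -- The members of cl(φ) in which every ∃-witness z is taken from Zs; f is fuel (size φ < f suffices).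
    clOver : ℕ → Form Sg → List (List (Form Sg))
    clOver zero    _          = []
    clOver (suc f) (grd α)    = (grd α ∷ []) ∷ [] ∷ []
    clOver (suc f) (or φ ψ)   = (or φ ψ ∷ []) ∷ clOver f φ ++ clOver f ψ
    clOver (suc f) (and φ ψ)  = (and φ ψ ∷ []) ∷ map (uncurry _++_)
      (filter (uncurry (compatible? φ ψ)) (cartesianProduct (clOver f φ) (clOver f ψ)))
    clOver (suc f) (ex x C)   = (ex x C ∷ []) ∷ concatMap (λ z → clOver f (C [ z / x ])) (witnesses C)
    clOver (suc f) (gneg α C) = (gneg α C ∷ []) ∷ clOver f C

    clOver-sound : ∀ f φ {Γ} → Γ ∈ clOver f φ → Cl φ Γ
    clOver-sound (suc f) (grd α)    (here refl)         = cl-grd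
    clOver-sound (suc f) (grd α)    (there (here refl)) = cl-empty
    clOver-sound (suc f) (or φ ψ)   (here refl)         = cl-or
    clOver-sound (suc f) (or φ ψ)   (there Γ∈) with ∈-++⁻ (clOver f φ) Γ∈
    ... | inj₁ Γ∈φ = cl-orˡ (clOver-sound f φ Γ∈φ)
    ... | inj₂ Γ∈ψ = cl-orʳ (clOver-sound f ψ Γ∈ψ)
    clOver-sound (suc f) (and φ ψ)  (here refl)         = cl-and
    clOver-sound (suc f) (and φ ψ)  (there Θ∈)
      with (Γ , Δ) , p∈ , refl ← ∈-map⁻ (uncurry _++_) Θ∈
      with p∈φ×ψ , compat ← ∈-filter⁻ (uncurry (compatible? φ ψ)) p∈
      with Γ∈ , Δ∈ ← ∈-cartesianProduct⁻ (clOver f φ) (clOver f ψ) p∈φ×ψ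
      = cl-and₂ (clOver-sound f φ Γ∈) (clOver-sound f ψ Δ∈) compat
    clOver-sound (suc f) (ex x C)   (here refl)         = cl-ex
    clOver-sound (suc f) (ex x C)   (there Γ∈)
      with z , z∈ , Γ∈C[z/x] ← find (∈-concatMap⁻ (λ z → clOver f (C [ z / x ])) {witnesses C} Γ∈)
      with _ , z∉C ← ∈-filter⁻ (λ z → ¬? (z ∈? FVf C)) {xs = Zs} z∈
      = cl-ex₂ z z∉C (clOver-sound f (C [ z / x ]) Γ∈C[z/x])
    clOver-sound (suc f) (gneg α C) (here refl)         = cl-gneg
    clOver-sound (suc f) (gneg α C) (there Γ∈)          = cl-gneg₂ (clOver-sound f C Γ∈)

    module _ {c : ℕ} (3≤c : 3 ≤ c) (Zs-small : suc (length Zs) ≤ c * c) where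

      private instance
        c-nonZero : NonZero c
        c-nonZero = >-nonZero (≤-trans (s≤s z≤n) 3≤c)

      2≤c : 2 ≤ c
      2≤c = ≤-trans (n≤1+n 2) 3≤c

      length-clOver : ∀ f φ → length (clOver f φ) ≤ c ^ size φ
      length-clOver zero    φ          = z≤n
      length-clOver (suc f) (grd α)    = begin
        2             ≤⟨ 2≤c ⟩
        c             ≡⟨ *-identityʳ c ⟨
        c ^ 1         ≤⟨ ^-monoʳ-≤ c (sizeᵍ-pos α) ⟩
        c ^ sizeg α ∎
        where open ≤-Reasoning
      length-clOver (suc f) (or φ ψ)   = begin
        suc (length (clOver f φ ++ clOver f ψ))           ≡⟨ cong suc (length-++ (clOver f φ)) ⟩
        suc (length (clOver f φ) + length (clOver f ψ))   ≤⟨ s≤s (+-mono-≤ (length-clOver f φ) (length-clOver f ψ)) ⟩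
        suc (c ^ size φ + c ^ size ψ)                     ≤⟨ suc-+-≤-* 3≤c (m^n>0 c (size φ)) (m^n>0 c (size ψ)) ⟩
        c * (c ^ size φ * c ^ size ψ)                     ≡⟨ cong (c *_) (^-distribˡ-+-* c (size φ) (size ψ)) ⟨
        c ^ size (or φ ψ) ∎
        where open ≤-Reasoning
      length-clOver (suc f) (and φ ψ)  = begin
        suc (length (map (uncurry _++_) (filter _ pairs)))  ≡⟨ cong suc (length-map (uncurry _++_) (filter _ pairs)) ⟩
        suc (length (filter _ pairs))                         ≤⟨ s≤s (length-filter (uncurry (compatible? φ ψ)) pairs) ⟩
        suc (length pairs)                                    ≡⟨ cong suc (length-cartesianProduct (clOver f φ) (clOver f ψ)) ⟩
        suc (length (clOver f φ) * length (clOver f ψ))       ≤⟨ s≤s (*-mono-≤ (length-clOver f φ) (length-clOver f ψ)) ⟩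
        suc (c ^ size φ * c ^ size ψ)                         ≤⟨ suc-≤-* 2≤c (*-mono-≤ (m^n>0 c (size φ)) (m^n>0 c (size ψ))) ⟩
        c * (c ^ size φ * c ^ size ψ)                         ≡⟨ cong (c *_) (^-distribˡ-+-* c (size φ) (size ψ)) ⟨
        c ^ size (and φ ψ) ∎
        where
          open ≤-Reasoning
          pairs = cartesianProduct (clOver f φ) (clOver f ψ)
      length-clOver (suc f) (ex x C)   = begin
        suc (length (concatMap (λ z → clOver f (C [ z / x ])) (witnesses C))) ≤⟨ s≤s (length-concatMap-≤ _ (witnesses C) each) ⟩
        suc (length (witnesses C) * c ^ size C)                               ≤⟨ s≤s (*-monoˡ-≤ (c ^ size C) (length-filter _ Zs)) ⟩
        suc (length Zs * c ^ size C)                                          ≤⟨ suc-*-≤-* {c} Zs-small (m^n>0 c (size C)) ⟩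
        c ^ size (ex x C) ∎
        where
          open ≤-Reasoning
          each : ∀ z → length (clOver f (C [ z / x ])) ≤ c ^ size C
          each z = subst (λ k → length (clOver f (C [ z / x ])) ≤ c ^ k) (size-renf _ C) (length-clOver f (C [ z / x ]))
      length-clOver (suc f) (gneg α C) = begin
        suc (length (clOver f C))       ≤⟨ s≤s (length-clOver f C) ⟩
        suc (c ^ size C)                ≤⟨ s≤s (^-monoʳ-≤ c (m≤n+m (size C) (suc (sizeg α)))) ⟩
        suc (c ^ suc (sizeg α + size C)) ≤⟨ suc-≤-* 2≤c (m^n>0 c (suc (sizeg α + size C))) ⟩
        c ^ size (gneg α C) ∎
        where open ≤-Reasoning

    module Replay {P : Var → Var} (P-inj : Injective _≡_ _≡_ P) {U : List Var} (P-runs : RunPreservingOn U P)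
                  (P-into : ∀ {u} → u ∈ U → P u ∈ Zs) where
      open Commute P-inj P-runs

      ∉-map : ∀ {z L} → z ∉ L → P z ∉ map P L
      ∉-map z∉L Pz∈ with u , u∈L , Pz≡Pu ← ∈-map⁻ P Pz∈ = z∉L (subst (_∈ _) (sym (P-inj Pz≡Pu)) u∈L)

      compatible-map : ∀ φ ψ Γ Δ → Compatible φ ψ Γ Δ →
                       Compatible (mapVars P φ) (mapVars P ψ) (map (mapVars P) Γ) (map (mapVars P) Δ)
      compatible-map φ ψ Γ Δ compat v v∈Γ v∈Δ
        rewrite FVs-mapVars P-inj Γ | FVs-mapVars P-inj Δ | FV-mapVars P-inj φ | FV-mapVars P-inj ψ
        with u , u∈Γ , refl ← ∈-map⁻ P v∈Γ
        with u′ , u′∈Δ , Pu≡Pu′ ← ∈-map⁻ P v∈Δ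
        with refl ← P-inj Pu≡Pu′
        with u∈φ , u∈ψ ← compat u u∈Γ u′∈Δ
        = ∈-map⁺ P u∈φ , ∈-map⁺ P u∈ψ

      mapVars-∈-clOver : ∀ {φ Γ} (d : Cl φ Γ) {f} → size φ < f → usedVars d ⊆ U →
                         map (mapVars P) Γ ∈ clOver f (mapVars P φ)
      mapVars-∈-clOver cl-grd   (s≤s _) _ = here refl
      mapVars-∈-clOver cl-empty (s≤s _) _ = there (here refl)
      mapVars-∈-clOver cl-or    (s≤s _) _ = here refl
      mapVars-∈-clOver cl-and   (s≤s _) _ = here refl
      mapVars-∈-clOver cl-ex    (s≤s _) _ = here refl
      mapVars-∈-clOver cl-gneg  (s≤s _) _ = here refl
      mapVars-∈-clOver {or φ ψ} (cl-orˡ d) (s≤s size≤f) ⊆U =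
        there (∈-++⁺ˡ (mapVars-∈-clOver d (≤-trans (s≤s (m≤m+n _ _)) size≤f) (⊆U ∘ ∈-++⁺ʳ (vars (or φ ψ)))))
      mapVars-∈-clOver {or φ ψ} (cl-orʳ d) {suc f} (s≤s size≤f) ⊆U =
        there (∈-++⁺ʳ (clOver f (mapVars P φ))
                      (mapVars-∈-clOver d (≤-trans (s≤s (m≤n+m _ _)) size≤f) (⊆U ∘ ∈-++⁺ʳ (vars (or φ ψ)))))
      mapVars-∈-clOver {and φ ψ} (cl-and₂ {Γ = Γ} {Δ} d e compat) (s≤s size≤f) ⊆U =
        subst (_∈ _) (sym (map-++ (mapVars P) Γ Δ))
          (there (∈-map⁺ (uncurry _++_)
                   (∈-filter⁺ (uncurry (compatible? (mapVars P φ) (mapVars P ψ))) (∈-cartesianProduct⁺ Γ′∈ Δ′∈)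
                              (compatible-map φ ψ Γ Δ compat))))
        where
          Γ′∈ = mapVars-∈-clOver d (≤-trans (s≤s (m≤m+n _ _)) size≤f) (⊆U ∘ ∈-++⁺ʳ (vars (and φ ψ)) ∘ ∈-++⁺ˡ)
          Δ′∈ = mapVars-∈-clOver e (≤-trans (s≤s (m≤n+m _ _)) size≤f)
                                 (⊆U ∘ ∈-++⁺ʳ (vars (and φ ψ)) ∘ ∈-++⁺ʳ (usedVars d))
      mapVars-∈-clOver {ex x C} {Γ} (cl-ex₂ z z∉C d) {suc f} (s≤s size≤f) ⊆U =
        there (∈-concatMap⁺ _ (lose (∈-filter⁺ (λ z → ¬? (z ∈? FVf (mapVars P C))) (P-into z∈U) Pz∉)
                                    Γ′∈))
        where
          z∈U : z ∈ U
          z∈U = ⊆U (∈-++⁺ʳ (vars (ex x C)) (here refl))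
          d⊆U : usedVars d ⊆ U
          d⊆U = ⊆U ∘ ∈-++⁺ʳ (vars (ex x C)) ∘ there
          Pz∉ : P z ∉ FVf (mapVars P C)
          Pz∉ = ∉-map z∉C ∘ subst (P z ∈_) (FV-mapVars P-inj C)
          size< : size (C [ z / x ]) < f
          size< = subst (_< f) (sym (size-renf _ C)) (≤-trans (n≤1+n _) size≤f)
          Γ′∈ : map (mapVars P) Γ ∈ clOver f (mapVars P C [ P z / P x ])
          Γ′∈ = subst (λ A → map (mapVars P) Γ ∈ clOver f A)
                      (mapVars-[/] C x z (⊆U ∘ ∈-++⁺ˡ ∘ there) z∈U (d⊆U ∘ ∈-++⁺ˡ))
                      (mapVars-∈-clOver d size< d⊆U)
      mapVars-∈-clOver {gneg α C} (cl-gneg₂ d) (s≤s size≤f) ⊆U =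
        there (mapVars-∈-clOver d (≤-trans (s≤s (m≤n⇒m≤1+n (m≤n+m _ _))) size≤f) (⊆U ∘ ∈-++⁺ʳ (vars (gneg α C))))

  ≈ren-mapVars : (π : Var ↔ Var) → ∀ Γ → Γ ≈ren map (mapVars (Inverse.to π)) Γ
  ≈ren-mapVars π Γ = ↔-sym π , All.tabulate (λ {ψ} ψ∈Γ → lose (∈-map⁺ _ ψ∈Γ) (nl-round-trip ψ))
                             , All-map⁺ (All.tabulate (λ {ψ} ψ∈Γ → lose ψ∈Γ (nl-round-trip ψ)))
    where
      nl-round-trip : ∀ ψ → nl ψ ≡ nrf (Inverse.from π) (nl (mapVars (Inverse.to π) ψ))
      nl-round-trip ψ = sym (trans (cong (nrf _) (nlf-mapVars (Injection.injective (↔⇒↣ π)) [] ψ))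
                                   (nrf-inverse (Inverse.strictlyInverseʳ π) (nl ψ)))

module Representatives {Sg : Signature} (φ : Form Sg) where

  private
    n : ℕ
    n = size φ

    Zs : List Var
    Zs = nearby (n * n) (vars φ)

  open Enumeration {Sg} Zs

  representatives : List (List (Form Sg))
  representatives = clOver (suc n) φ

  representatives-sound : All (Cl φ) representatives
  representatives-sound = All.tabulate (clOver-sound (suc n) φ)

  length-representatives : length representatives ≤ (2 * n) ^ (2 * n)
  length-representatives = begin
    length (clOver (suc n) φ) ≤⟨ length-clOver (three≤square (size-pos φ)) Zs-small (suc n) φ ⟩
    ((2 * n) ^ 2) ^ n         ≡⟨ ^-*-assoc (2 * n) 2 n ⟩
    (2 * n) ^ (2 * n) ∎
    where
      open ≤-Reasoning
      Zs-small : suc (length Zs) ≤ (2 * n) ^ 2 * (2 * n) ^ 2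
      Zs-small = ≤-trans (s≤s (≤-trans (length-nearby (n * n) (vars φ)) (*-monoˡ-≤ _ (s≤s (length-vars φ)))))
                         (nearby-count-≤ (size-pos φ))

  -- Rename the variables of a derivation by a bijection fixing vars φ and moving the other variables into Zs;
  -- the renamed derivation is one that clOver enumerates.
  representatives-cover : ∀ Γ → Cl φ Γ → Any (Γ ≈ren_) representatives
  representatives-cover Γ d = lose renamed∈ (≈ren-mapVars π Γ)
    where
      U = usedVars d
      open Compression U (vars φ) ∈-++⁺ˡ using (compress; compress-injective; compress-runs; compress-near; compress-fixes-V)

      π-extends : ∃[ π ] ∀ {u} → u ∈ U → Inverse.to π u ≡ compress u
      π-extends = extend-to-bijection compress U compress-injective
      π = proj₁ π-extends
      P = Inverse.to π

      P-into : ∀ {u} → u ∈ U → P u ∈ Zs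
      P-into {u} u∈U = ∈-nearby (Near-mono (length-usedVars d)
        (subst (Near (length U) (vars φ)) (sym (proj₂ π-extends u∈U)) (compress-near u)))

      P-fixes-φ : mapVars P φ ≡ φ
      P-fixes-φ = mapVars-fixes φ (λ v∈φ → trans (proj₂ π-extends (∈-++⁺ˡ v∈φ)) (compress-fixes-V v∈φ))

      open Replay (Injection.injective (↔⇒↣ π)) (RunPreservingOn-cong (sym ∘ proj₂ π-extends) compress-runs) P-into

      renamed∈ : map (mapVars P) Γ ∈ representatives
      renamed∈ = subst (λ (A : Form Sg) → map (mapVars P) Γ ∈ clOver (suc n) A) P-fixes-φ
                       (mapVars-∈-clOver d ≤-refl id)

open Representatives

proposition7 : (Sg : Signature) (φ : Form Sg) → GNFO φ →
    ClassesAtMost φ ((2 * size φ) ^ (2 * size φ))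
proposition7 Sg φ _ = representatives φ , representatives-sound φ , length-representatives φ , representatives-cover φ
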